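{- For every odd integer $k \geq 3$, $g_{\mathbb{Z}_2}(k) = 2$.
   Context: For a ring $R$ and an integer $k > 1$, let $R^k$ denote the additive semigroup generated by all $k$-th powers of elements of $R$. The Waring number $g_R(k)$ is the smallest positive integer such that every element of $R^k$ can be written as a sum of at most $g_R(k)$ $k$-th powers of elements of $R$. $\mathbb{Z}_2$ denotes the $2$-adic integers. -}

module Defs where

open import Data.Nat using (ℕ; zero; suc; _+_; _*_; _^_; _≤_; _<_; NonZero)
open import Data.Nat.Properties using (m^n≢0; +-comm)
open import Data.Nat.DivMod
open import Data.List using (List; []; _∷_; length; foldr)
open import Data.Product using (Σ; _×_; _,_)
open import Relation.Binary.PropositionalEquality
open ≡-Reasoning

nz : ∀ n → NonZero (2 ^ n)
nz n = m^n≢0 2 n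

infixl 7 _mod2^_
_mod2^_ : ℕ → ℕ → ℕ
m mod2^ n = _%_ m (2 ^ n) {{nz n}}

mod-mod : ∀ m n → (m mod2^ (suc n)) mod2^ n ≡ m mod2^ n
mod-mod m n = begin
    (m mod2^ (suc n)) mod2^ n
  ≡⟨ sym ([m+kn]%n≡m%n (m mod2^ (suc n)) (q * 2) N {{nz n}}) ⟩
    (m mod2^ (suc n) + q * 2 * N) mod2^ n
  ≡⟨ cong (λ t → (m mod2^ (suc n) + t) mod2^ n) (Data.Nat.Properties.*-assoc q 2 N) ⟩
    (m mod2^ (suc n) + q * (2 ^ suc n)) mod2^ n
  ≡⟨ cong (_mod2^ n) (sym (m≡m%n+[m/n]*n m (2 ^ suc n) {{nz (suc n)}})) ⟩
    m mod2^ n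
  ∎
  where
    N = 2 ^ n
    q = _/_ m (2 ^ suc n) {{nz (suc n)}}

-- The ring ℤ₂ of 2-adic integers, as the inverse limit lim ℤ/2^nℤ:
-- a 2-adic integer is a compatible sequence of residues x_n ∈ [0, 2^n)
-- with x_{n+1} ≡ x_n (mod 2^n).

record ℤ₂ : Set where
  field
    res   : ℕ → ℕ
    bound : ∀ n → res n < 2 ^ n
    coh   : ∀ n → res (suc n) mod2^ n ≡ res n
open ℤ₂ public

_≈_ : ℤ₂ → ℤ₂ → Set
x ≈ y = ∀ n → res x n ≡ res y n

private
  lift₂ : (f : ℕ → ℕ → ℕ)
        → (∀ a b n → f a b mod2^ n ≡ f (a mod2^ n) (b mod2^ n) mod2^ n)
        → ℤ₂ → ℤ₂ → ℤ₂
  lift₂ f hom x y = record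
    { res   = λ n → f (res x n) (res y n) mod2^ n
    ; bound = λ n → m%n<n (f (res x n) (res y n)) (2 ^ n) {{nz n}}
    ; coh   = λ n → begin
        f (res x (suc n)) (res y (suc n)) mod2^ (suc n) mod2^ n
      ≡⟨ mod-mod (f (res x (suc n)) (res y (suc n))) n ⟩
        f (res x (suc n)) (res y (suc n)) mod2^ n
      ≡⟨ hom (res x (suc n)) (res y (suc n)) n ⟩
        f (res x (suc n) mod2^ n) (res y (suc n) mod2^ n) mod2^ n
      ≡⟨ cong₂ (λ a b → f a b mod2^ n) (coh x n) (coh y n) ⟩
        f (res x n) (res y n) mod2^ n
      ∎
    }

0ℤ₂ : ℤ₂
0ℤ₂ = record
  { res   = λ n → 0 mod2^ n
  ; bound = λ n → m%n<n 0 (2 ^ n) {{nz n}}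
  ; coh   = λ n → mod-mod 0 n }

1ℤ₂ : ℤ₂
1ℤ₂ = record
  { res   = λ n → 1 mod2^ n
  ; bound = λ n → m%n<n 1 (2 ^ n) {{nz n}}
  ; coh   = λ n → mod-mod 1 n }

infixl 6 _+₂_
infixl 7 _*₂_
_+₂_ : ℤ₂ → ℤ₂ → ℤ₂
_+₂_ = lift₂ _+_ (λ a b n → %-distribˡ-+ a b (2 ^ n) {{nz n}})

_*₂_ : ℤ₂ → ℤ₂ → ℤ₂
_*₂_ = lift₂ _*_ (λ a b n → %-distribˡ-* a b (2 ^ n) {{nz n}})

_^₂_ : ℤ₂ → ℕ → ℤ₂
x ^₂ zero  = 1ℤ₂
x ^₂ suc k = x *₂ (x ^₂ k)

sumPow : ℕ → List ℤ₂ → ℤ₂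
sumPow k = foldr (λ y acc → (y ^₂ k) +₂ acc) 0ℤ₂

InPowSemigroup : ℕ → ℤ₂ → Set
InPowSemigroup k x = Σ (List ℤ₂) λ ys → (1 ≤ length ys) × (x ≈ sumPow k ys)

WaringBound : ℕ → ℕ → Set
WaringBound k g = ∀ x → InPowSemigroup k x →
  Σ (List ℤ₂) λ ys → (length ys ≤ g) × (x ≈ sumPow k ys)

WaringNumberIs : ℕ → ℕ → Set
WaringNumberIs k g =
  (1 ≤ g) × WaringBound k g × (∀ g′ → 1 ≤ g′ → WaringBound k g′ → g ≤ g′)

{-# OPTIONS --safe #-}
-- For odd k and odd r, (r + 2m)^k − r^k = 2m · G with G a sum of k odd terms, so
-- (r + 2m)^k ≡ r^k + 2m (mod 4m). Hence an odd k-th root of x modulo 2^(n+1) is corrected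
-- by 2^(n+1), if necessary, into one modulo 2^(n+2), and every odd 2-adic integer is a
-- k-th power; an even x is (x − 1) + 1^k. Conversely 2 = 1^k + 1^k is not a single k-th
-- power, already modulo 8: odd k-th powers are odd, and even ones vanish mod 8 as k ≥ 3.
module Submission where

open import Defs
open import Data.Nat using (ℕ; zero; suc; _+_; _*_; _^_; _∸_; _≤_; _<_; _%_; _/_; NonZero; z≤n; s≤s; _≟_)
open import Data.Nat.Properties
open import Data.Nat.DivMod
open import Data.Nat.Divisibility using (divides; ∣-refl)
open import Data.List using (List; []; _∷_; length)
open import Data.Product using (Σ; _×_; _,_; proj₁; proj₂)
open import Data.Sum using (_⊎_; inj₁; inj₂)
open import Data.Nat.Tactic.RingSolver using (solve-∀)
open import Relation.Nullary using (¬_; yes; no; contradiction)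
open import Relation.Binary.PropositionalEquality using (_≡_; _≢_; refl; sym; trans; cong; cong₂; subst; module ≡-Reasoning)
open ≡-Reasoning

^-odd : ∀ {r} k → r % 2 ≡ 1 → r ^ k % 2 ≡ 1
^-odd zero _ = refl
^-odd {r} (suc k) r-odd = begin
  r * r ^ k % 2               ≡⟨ %-distribˡ-* r (r ^ k) 2 ⟩
  (r % 2) * (r ^ k % 2) % 2   ≡⟨ cong₂ (λ a b → a * b % 2) r-odd (^-odd k r-odd) ⟩
  1                           ∎

-- a^k − b^k = (a − b) · geomSum a b k
geomSum : ℕ → ℕ → ℕ → ℕ
geomSum a b zero    = 0
geomSum a b (suc k) = a ^ k + b * geomSum a b k

[b+d]^k≡b^k+d*geomSum : ∀ b d k → (b + d) ^ k ≡ b ^ k + d * geomSum (b + d) b k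
[b+d]^k≡b^k+d*geomSum b d zero    = cong suc (sym (*-zeroʳ d))
[b+d]^k≡b^k+d*geomSum b d (suc k) = begin
  (b + d) * (b + d) ^ k                     ≡⟨ cong ((b + d) *_) ih ⟩
  (b + d) * (b ^ k + d * G)                 ≡⟨ expand b d (b ^ k) G ⟩
  b * b ^ k + d * (b ^ k + d * G + b * G)   ≡⟨ cong (λ t → b * b ^ k + d * (t + b * G)) ih ⟨
  b * b ^ k + d * ((b + d) ^ k + b * G)     ∎
  where
    G  = geomSum (b + d) b k
    ih = [b+d]^k≡b^k+d*geomSum b d k
    expand : ∀ b d B G → (b + d) * (B + d * G) ≡ b * B + d * (B + d * G + b * G)
    expand = solve-∀

geomSum-parity : ∀ {a b} k → a % 2 ≡ 1 → b % 2 ≡ 1 → geomSum a b k % 2 ≡ k % 2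
geomSum-parity zero _ _ = refl
geomSum-parity {a} {b} (suc k) a-odd b-odd = begin
  (a ^ k + b * G) % 2                     ≡⟨ %-distribˡ-+ (a ^ k) (b * G) 2 ⟩
  (a ^ k % 2 + b * G % 2) % 2             ≡⟨ cong₂ (λ u v → (u + v) % 2) (^-odd k a-odd) bG-parity ⟩
  (1 + k % 2) % 2                         ≡⟨ %-distribˡ-+ 1 k 2 ⟨
  suc k % 2                               ∎
  where
    G = geomSum a b k
    bG-parity : b * G % 2 ≡ k % 2
    bG-parity = begin
      b * G % 2               ≡⟨ %-distribˡ-* b G 2 ⟩
      (b % 2) * (G % 2) % 2   ≡⟨ cong₂ (λ u v → u * v % 2) b-odd (geomSum-parity k a-odd b-odd) ⟩
      (1 * (k % 2)) % 2       ≡⟨ cong (_% 2) (*-identityˡ (k % 2)) ⟩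
      k % 2 % 2               ≡⟨ m%n%n≡m%n k 2 ⟩
      k % 2                   ∎

%2-flip : ∀ i j → i % 2 ≢ j % 2 → (i + 1) % 2 ≡ j % 2
%2-flip i j i≢j = trans (%-distribˡ-+ i 1 2) (flip (i % 2) (j % 2) (m%n<n i 2) (m%n<n j 2) i≢j)
  where
    flip : ∀ u v → u < 2 → v < 2 → u ≢ v → (u + 1) % 2 ≡ v
    flip 0 0 _ _ u≢v = contradiction refl u≢v
    flip 0 1 _ _ _   = refl
    flip 1 0 _ _ _   = refl
    flip 1 1 _ _ u≢v = contradiction refl u≢v
    flip (suc (suc _)) _ (s≤s (s≤s ())) _ _
    flip _ (suc (suc _)) _ (s≤s (s≤s ())) _

%[2*N]≡[/N]%2*N+%N : ∀ m N .{{_ : NonZero N}} .{{_ : NonZero (2 * N)}} →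
                     m % (2 * N) ≡ m / N % 2 * N + m % N
%[2*N]≡[/N]%2*N+%N m N = begin
  m % (2 * N)                    ≡⟨ cong (_% (2 * N)) (trans (m≡m%n+[m/n]*n m N) (+-comm (m % N) _)) ⟩
  (m / N * N + m % N) % (2 * N)  ≡⟨ [m*n+o]%[p*n]≡[m*n]%[p*n]+o (m / N) 2 (m%n<n m N) ⟩
  m / N * N % (2 * N) + m % N    ≡⟨ cong (_+ m % N) (m%n*o≡m*o%[n*o] (m / N) 2 N) ⟨
  m / N % 2 * N + m % N          ∎

[a+N]%[2*N]≡b%[2*N] : ∀ a b N .{{_ : NonZero N}} .{{_ : NonZero (2 * N)}} →
                      a % N ≡ b % N → a % (2 * N) ≢ b % (2 * N) →
                      (a + N) % (2 * N) ≡ b % (2 * N)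
[a+N]%[2*N]≡b%[2*N] a b N a≡b a≢b = begin
  (a + N) % (2 * N)                     ≡⟨ split (a + N) ⟩
  (a + N) / N % 2 * N + (a + N) % N     ≡⟨ cong₂ (λ q r → q % 2 * N + r) [a+N]/N≡a/N+1 ([m+n]%n≡m%n a N) ⟩
  (a / N + 1) % 2 * N + a % N           ≡⟨ cong₂ (λ q r → q * N + r) (%2-flip (a / N) (b / N) bits-differ) a≡b ⟩
  b / N % 2 * N + b % N                 ≡⟨ split b ⟨
  b % (2 * N)                           ∎
  where
    split : ∀ m → m % (2 * N) ≡ m / N % 2 * N + m % N
    split m = %[2*N]≡[/N]%2*N+%N m N
    [a+N]/N≡a/N+1 : (a + N) / N ≡ a / N + 1
    [a+N]/N≡a/N+1 = trans (+-distrib-/-∣ʳ a ∣-refl) (cong (a / N +_) (n/n≡1 N))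
    bits-differ : a / N % 2 ≢ b / N % 2
    bits-differ eq = a≢b (begin
      a % (2 * N)              ≡⟨ split a ⟩
      a / N % 2 * N + a % N    ≡⟨ cong₂ (λ q r → q * N + r) eq a≡b ⟩
      b / N % 2 * N + b % N    ≡⟨ split b ⟨
      b % (2 * N)              ∎)

+-even-odd : ∀ r m → r % 2 ≡ 1 → (r + 2 * m) % 2 ≡ 1
+-even-odd r m r-odd = trans (cong (λ t → (r + t) % 2) (*-comm 2 m)) (trans ([m+kn]%n≡m%n r m 2) r-odd)

[r+2m]^k≡r^k+2m : ∀ k r m .{{_ : NonZero (2 * (2 * m))}} → k % 2 ≡ 1 → r % 2 ≡ 1 →
                  (r + 2 * m) ^ k % (2 * (2 * m)) ≡ (r ^ k + 2 * m) % (2 * (2 * m))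
[r+2m]^k≡r^k+2m k r m k-odd r-odd = begin
  (r + P) ^ k % Q                  ≡⟨ cong (_% Q) ([b+d]^k≡b^k+d*geomSum r P k) ⟩
  (r ^ k + P * G) % Q              ≡⟨ cong (λ t → (r ^ k + P * t) % Q) G≡1+g*2 ⟩
  (r ^ k + P * (1 + g * 2)) % Q    ≡⟨ cong (_% Q) (regroup (r ^ k) P g) ⟩
  (r ^ k + P + g * Q) % Q          ≡⟨ [m+kn]%n≡m%n (r ^ k + P) g Q ⟩
  (r ^ k + P) % Q                  ∎
  where
    P = 2 * m
    Q = 2 * P
    G = geomSum (r + P) r k
    g = G / 2
    G≡1+g*2 : G ≡ 1 + g * 2
    G≡1+g*2 = trans (m≡m%n+[m/n]*n G 2)
                (cong (_+ g * 2) (trans (geomSum-parity k (+-even-odd r m r-odd) r-odd) k-odd))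
    regroup : ∀ R P g → R + P * (1 + g * 2) ≡ R + P + g * (2 * P)
    regroup = solve-∀

m*[n%d]%d≡m*n%d : ∀ m n d .{{_ : NonZero d}} → m * (n % d) % d ≡ m * n % d
m*[n%d]%d≡m*n%d m n d = begin
  m * (n % d) % d              ≡⟨ %-distribˡ-* m (n % d) d ⟩
  m % d * (n % d % d) % d      ≡⟨ cong (λ t → m % d * t % d) (m%n%n≡m%n n d) ⟩
  m % d * (n % d) % d          ≡⟨ %-distribˡ-* m n d ⟨
  m * n % d                    ∎

res-^₂ : ∀ y k n → res (y ^₂ k) n ≡ res y n ^ k mod2^ n
res-^₂ y zero    n = refl
res-^₂ y (suc k) n = begin
  a * res (y ^₂ k) n % N   ≡⟨ cong (λ t → a * t % N) (res-^₂ y k n) ⟩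
  a * (a ^ k % N) % N      ≡⟨ m*[n%d]%d≡m*n%d a (a ^ k) N ⟩
  a * a ^ k % N            ∎
  where
    N = 2 ^ n
    instance _ = nz n
    a = res y n

res-1^₂ : ∀ k n → res (1ℤ₂ ^₂ k) n ≡ 1 mod2^ n
res-1^₂ zero    n = refl
res-1^₂ (suc k) n = begin
  1 % N * res (1ℤ₂ ^₂ k) n % N   ≡⟨ cong (λ t → 1 % N * t % N) (res-1^₂ k n) ⟩
  1 % N * (1 % N) % N            ≡⟨ %-distribˡ-* 1 1 N ⟨
  1 % N                          ∎
  where
    N = 2 ^ n
    instance _ = nz n

res-+₂0ℤ₂ : ∀ z n → res (z +₂ 0ℤ₂) n ≡ res z n
res-+₂0ℤ₂ z n = begin
  (res z n + 0 % N) % N   ≡⟨ cong (λ t → (res z n + t) % N) (m<n⇒m%n≡m (m^n>0 2 n)) ⟩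
  (res z n + 0) % N       ≡⟨ cong (_% N) (+-identityʳ (res z n)) ⟩
  res z n % N             ≡⟨ m<n⇒m%n≡m (bound z n) ⟩
  res z n                 ∎
  where
    N = 2 ^ n
    instance _ = nz n

sumPow-[y]≈y^k : ∀ k y → sumPow k (y ∷ []) ≈ (y ^₂ k)
sumPow-[y]≈y^k k y = res-+₂0ℤ₂ (y ^₂ k)

res₁-parity : ∀ x → res x 1 ≡ 0 ⊎ res x 1 ≡ 1
res₁-parity x with res x 1 | bound x 1
... | 0 | _ = inj₁ refl
... | 1 | _ = inj₂ refl
... | suc (suc _) | s≤s (s≤s ())

hensel-step : ∀ k r n (x : ℤ₂) → k % 2 ≡ 1 → r % 2 ≡ 1 →
              r ^ k mod2^ suc n ≡ res x (suc n) →
              r ^ k mod2^ suc (suc n) ≢ res x (suc (suc n)) →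
              (r + 2 ^ suc n) ^ k mod2^ suc (suc n) ≡ res x (suc (suc n))
hensel-step k r n x k-odd r-odd r^k≡x r^k≢x = begin
  (r + 2 ^ suc n) ^ k mod2^ suc (suc n)    ≡⟨ [r+2m]^k≡r^k+2m k r (2 ^ n) k-odd r-odd ⟩
  (r ^ k + 2 ^ suc n) mod2^ suc (suc n)    ≡⟨ [a+N]%[2*N]≡b%[2*N] (r ^ k) x₊ (2 ^ suc n) r^k≡x₊ r^k≢x₊ ⟩
  x₊ mod2^ suc (suc n)                     ≡⟨ x₊%≡x₊ ⟩
  x₊                                       ∎
  where
    instance
      _ = nz n
      _ = nz (suc n)
      _ = nz (suc (suc n))
    x₊ = res x (suc (suc n))
    x₊%≡x₊ : x₊ mod2^ suc (suc n) ≡ x₊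
    x₊%≡x₊ = m<n⇒m%n≡m (bound x (suc (suc n)))
    r^k≡x₊ : r ^ k mod2^ suc n ≡ x₊ mod2^ suc n
    r^k≡x₊ = trans r^k≡x (sym (coh x (suc n)))
    r^k≢x₊ : r ^ k mod2^ suc (suc n) ≢ x₊ mod2^ suc (suc n)
    r^k≢x₊ eq = r^k≢x (trans eq x₊%≡x₊)

module OddRoot (k : ℕ) (k-odd : k % 2 ≡ 1) (x : ℤ₂) (x-odd : res x 1 ≡ 1) where

  record Approx (n : ℕ) : Set where
    field
      root     : ℕ
      root<    : root < 2 ^ suc n
      root-odd : root % 2 ≡ 1
      root^k≡x : root ^ k mod2^ suc n ≡ res x (suc n)
  open Approx

  Refinement : ∀ {n} → Approx n → Set
  Refinement {n} a = Σ (Approx (suc n)) λ a′ → root a′ mod2^ suc n ≡ root a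

  keep : ∀ {n} (a : Approx n) → root a ^ k mod2^ suc (suc n) ≡ res x (suc (suc n)) → Refinement a
  keep {n} a lifted = record
    { root     = root a
    ; root<    = <-≤-trans (root< a) (m≤m+n (2 ^ suc n) _)
    ; root-odd = root-odd a
    ; root^k≡x = lifted
    } , m<n⇒m%n≡m (root< a)
    where instance _ = nz (suc n)

  shift : ∀ {n} (a : Approx n) → root a ^ k mod2^ suc (suc n) ≢ res x (suc (suc n)) → Refinement a
  shift {n} a not-lifted = record
    { root     = root a + P
    ; root<    = subst (root a + P <_) (cong (P +_) (sym (+-identityʳ P))) (+-monoˡ-< P (root< a))
    ; root-odd = +-even-odd (root a) (2 ^ n) (root-odd a)
    ; root^k≡x = hensel-step k (root a) n x k-odd (root-odd a) (root^k≡x a) not-lifted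
    } , trans ([m+n]%n≡m%n (root a) P) (m<n⇒m%n≡m (root< a))
    where
      P = 2 ^ suc n
      instance _ = nz (suc n)

  refine : ∀ {n} (a : Approx n) → Refinement a
  refine {n} a with root a ^ k mod2^ suc (suc n) ≟ res x (suc (suc n))
  ... | yes lifted     = keep a lifted
  ... | no  not-lifted = shift a not-lifted

  approx : ∀ n → Approx n
  approx zero    = record
    { root = 1 ; root< = s≤s (s≤s z≤n) ; root-odd = refl
    ; root^k≡x = trans (cong (_% 2) (^-zeroˡ k)) (sym x-odd) }
  approx (suc n) = proj₁ (refine (approx n))

  residue : ℕ → ℕ
  residue zero    = 0
  residue (suc n) = root (approx n)

  root₂ : ℤ₂
  root₂ = record { res = residue ; bound = residue< ; coh = residue-coh }
    where
      residue< : ∀ n → residue n < 2 ^ n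
      residue< zero    = s≤s z≤n
      residue< (suc n) = root< (approx n)
      residue-coh : ∀ n → residue (suc n) mod2^ n ≡ residue n
      residue-coh zero    = n%1≡0 1
      residue-coh (suc n) = proj₂ (refine (approx n))

  x≈root₂^k : x ≈ (root₂ ^₂ k)
  x≈root₂^k zero    = trans (n<1⇒n≡0 (bound x 0)) (sym (n<1⇒n≡0 (bound (root₂ ^₂ k) 0)))
  x≈root₂^k (suc n) = sym (trans (res-^₂ root₂ k (suc n)) (root^k≡x (approx n)))

odd⇒kthPower : ∀ k → k % 2 ≡ 1 → ∀ x → res x 1 ≡ 1 → Σ ℤ₂ λ y → x ≈ (y ^₂ k)
odd⇒kthPower k k-odd x x-odd = root₂ , x≈root₂^k
  where open OddRoot k k-odd x x-odd

-1ℤ₂ : ℤ₂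
-1ℤ₂ = record
  { res   = λ n → 2 ^ n ∸ 1
  ; bound = λ n → ∸-monoʳ-< (s≤s z≤n) (m^n>0 2 n)
  ; coh   = λ n → [2*N∸1]%N≡N∸1 (2 ^ n) {{nz n}}
  }
  where
    [2*N∸1]%N≡N∸1 : ∀ N .{{_ : NonZero N}} → (2 * N ∸ 1) % N ≡ N ∸ 1
    [2*N∸1]%N≡N∸1 (suc m) = begin
      (m + (suc m + 0)) % suc m   ≡⟨ cong (λ t → (m + t) % suc m) (+-identityʳ (suc m)) ⟩
      (m + suc m) % suc m         ≡⟨ [m+n]%n≡m%n m (suc m) ⟩
      m % suc m                   ≡⟨ m<n⇒m%n≡m (n<1+n m) ⟩
      m                           ∎

x-1≈y^k⇒x≈sumPow[y,1] : ∀ k x y → (x +₂ -1ℤ₂) ≈ (y ^₂ k) → x ≈ sumPow k (y ∷ 1ℤ₂ ∷ [])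
x-1≈y^k⇒x≈sumPow[y,1] k x y x-1≈y^k n = sym (begin
  (res (y ^₂ k) n + res (1ℤ₂ ^₂ k +₂ 0ℤ₂) n) % N
    ≡⟨ cong₂ (λ u v → (u + v) % N) (sym (x-1≈y^k n)) (trans (res-+₂0ℤ₂ (1ℤ₂ ^₂ k) n) (res-1^₂ k n)) ⟩
  ((a + (N ∸ 1)) % N + 1 % N) % N  ≡⟨ %-distribˡ-+ (a + (N ∸ 1)) 1 N ⟨
  (a + (N ∸ 1) + 1) % N            ≡⟨ cong (_% N) (+-assoc a (N ∸ 1) 1) ⟩
  (a + (N ∸ 1 + 1)) % N            ≡⟨ cong (λ t → (a + t) % N) (m∸n+n≡m (m^n>0 2 n)) ⟩
  (a + N) % N                      ≡⟨ [m+n]%n≡m%n a N ⟩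
  a % N                            ≡⟨ m<n⇒m%n≡m (bound x n) ⟩
  a                                ∎)
  where
    N = 2 ^ n
    instance _ = nz n
    a = res x n

waringBound-2 : ∀ k → k % 2 ≡ 1 → WaringBound k 2
waringBound-2 k k-odd x _ with res₁-parity x
... | inj₂ x-odd = y ∷ [] , s≤s z≤n , λ n → trans (x≈y^k n) (sym (sumPow-[y]≈y^k k y n))
  where open Σ (odd⇒kthPower k k-odd x x-odd) renaming (proj₁ to y; proj₂ to x≈y^k)
... | inj₁ x-even = y ∷ 1ℤ₂ ∷ [] , ≤-refl , x-1≈y^k⇒x≈sumPow[y,1] k x y x-1≈y^k
  where
    x-1-odd : res (x +₂ -1ℤ₂) 1 ≡ 1
    x-1-odd = cong (λ t → (t + 1) % 2) x-even
    open Σ (odd⇒kthPower k k-odd (x +₂ -1ℤ₂) x-1-odd) renaming (proj₁ to y; proj₂ to x-1≈y^k)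

[2t]^k%8≡0 : ∀ t k → 3 ≤ k → (t * 2) ^ k % 8 ≡ 0
[2t]^k%8≡0 t (suc (suc (suc j))) (s≤s (s≤s (s≤s _))) =
  trans (cong (_% 8) (regroup t ((t * 2) ^ j))) (m*n%n≡0 (t * t * t * (t * 2) ^ j) 8)
  where
    regroup : ∀ t M → t * 2 * (t * 2 * (t * 2 * M)) ≡ t * t * t * M * 8
    regroup = solve-∀

^%8≢2 : ∀ m k → 3 ≤ k → m ^ k % 8 ≢ 2
^%8≢2 m k k≥3 m^k≡2 with m % 2 in m%2 | m%n<n m 2
... | 0 | _ = contradiction (begin
  0                    ≡⟨ [2t]^k%8≡0 (m / 2) k k≥3 ⟨
  (m / 2 * 2) ^ k % 8  ≡⟨ cong (λ t → t ^ k % 8) m/2*2≡m ⟩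
  m ^ k % 8            ≡⟨ m^k≡2 ⟩
  2                    ∎) λ ()
  where
    m/2*2≡m : m / 2 * 2 ≡ m
    m/2*2≡m = sym (trans (m≡m%n+[m/n]*n m 2) (cong (_+ m / 2 * 2) m%2))
... | 1 | _ = contradiction (begin
  1                    ≡⟨ ^-odd k m%2 ⟨
  m ^ k % 2            ≡⟨ m∣n⇒o%n%m≡o%m 2 8 (m ^ k) (divides 4 refl) ⟨
  m ^ k % 8 % 2        ≡⟨ cong (_% 2) m^k≡2 ⟩
  0                    ∎) λ ()
... | suc (suc _) | s≤s (s≤s ())

res₃-sumPow[1,1] : ∀ k → res (sumPow k (1ℤ₂ ∷ 1ℤ₂ ∷ [])) 3 ≡ 2
res₃-sumPow[1,1] k =
  cong₂ (λ a b → (a + b) % 8) (res-1^₂ k 3) (trans (res-+₂0ℤ₂ (1ℤ₂ ^₂ k) 3) (res-1^₂ k 3))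

¬waringBound-1 : ∀ k → 3 ≤ k → ¬ WaringBound k 1
¬waringBound-1 k k≥3 wb = no-single (wb (sumPow k [1,1]) ([1,1] , s≤s z≤n , λ _ → refl))
  where
    [1,1] = 1ℤ₂ ∷ 1ℤ₂ ∷ []
    no-single : ¬ Σ (List ℤ₂) λ ys → (length ys ≤ 1) × (sumPow k [1,1] ≈ sumPow k ys)
    no-single ([] , _ , 2≈0) = contradiction (trans (sym (res₃-sumPow[1,1] k)) (2≈0 3)) λ ()
    no-single (y ∷ [] , _ , 2≈y^k) = ^%8≢2 (res y 3) k k≥3 (begin
      res y 3 ^ k % 8                ≡⟨ res-^₂ y k 3 ⟨
      res (y ^₂ k) 3                 ≡⟨ sumPow-[y]≈y^k k y 3 ⟨
      res (sumPow k (y ∷ [])) 3      ≡⟨ 2≈y^k 3 ⟨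
      res (sumPow k [1,1]) 3         ≡⟨ res₃-sumPow[1,1] k ⟩
      2                              ∎)
    no-single (_ ∷ _ ∷ _ , s≤s () , _)

lemma3p1 : ∀ (k : ℕ) → k % 2 ≡ 1 → 3 ≤ k → WaringNumberIs k 2
lemma3p1 k k-odd k≥3 = s≤s z≤n , waringBound-2 k k-odd , least
  where
    least : ∀ g → 1 ≤ g → WaringBound k g → 2 ≤ g
    least (suc zero)    _ wb = contradiction wb (¬waringBound-1 k k≥3)
    least (suc (suc _)) _ _  = s≤s (s≤s z≤n)
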